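{- Let $t$ be a non-negative integer, let $G$ be a $t$-connected chordal graph, and let $\tau:V(G)\to\mathbb{Z}$ satisfy $\tau(u)\leq t$ for every vertex $u$ of $G$. (i) For every clique $C$ of $G$ of order $t$ with vertices $v_0,v_1,\ldots,v_{t-1}$, the function $\sigma:V(G)\to\mathbb{N}_0$ with $\sigma(v_i)=\max\{\tau(v_i)-i,0\}$ for $i\in\{0,\ldots,t-1\}$ and $\sigma(u)=0$ for $u\notin C$ is a partial incentive of $(G,\tau)$. (ii) ${\rm pi}(G,\tau)\leq\binom{t+1}{2}$.
   Context: All graphs are finite, simple and undirected. For $\tau:V(G)\to\mathbb{Z}$, the hull $H_{(G,\tau)}(D)$ of $D\subseteq V(G)$ is the smallest set $H$ with $D\subseteq H$ such that $u\in H$ for every vertex $u$ with $|H\cap N_G(u)|\geq\tau(u)$. A function $\sigma:V(G)\to\mathbb{N}_0$ is a partial incentive of $(G,\tau)$ if $H_{(G,\tau-\sigma)}(\emptyset)=V(G)$, and ${\rm pi}(G,\tau)$ is the minimum of $\sum_{v}\sigma(v)$ over all partial incentives $\sigma$ of $(G,\tau)$. -}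

module Defs where

open import Data.Nat as ℕ using (ℕ; zero; suc)
open import Data.Integer as ℤ using (ℤ; +_; -[1+_])
open import Data.Bool using (Bool; true; false)
open import Data.Fin using (Fin; zero; suc; toℕ; inject₁; fromℕ)
open import Data.Fin.Subset using (Subset; _∈_; _∉_; _⊆_; _∩_; ∣_∣; ⊤; ⊥)
open import Data.Vec using (tabulate; sum)
open import Data.Product using (Σ; ∃; _×_; _,_)
open import Relation.Binary.PropositionalEquality using (_≡_; _≢_)
open import Relation.Nullary using (¬_)
open import Function.Definitions using (Injective)

record Graph : Set where
  field
    n      : ℕ
    adj    : Fin n → Fin n → Bool
    sym    : ∀ u v → adj u v ≡ adj v u
    irrefl : ∀ u → adj u u ≡ false

open Graph public

Adj : (G : Graph) → Fin (n G) → Fin (n G) → Set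
Adj G u v = adj G u v ≡ true

N : (G : Graph) → Fin (n G) → Subset (n G)
N G u = tabulate (λ v → adj G u v)

data Reach (G : Graph) (S : Subset (n G)) : Fin (n G) → Fin (n G) → Set where
  here : ∀ {u} → u ∈ S → Reach G S u u
  step : ∀ {u w v} → u ∈ S → Adj G u w → Reach G S w v → Reach G S u v

ConnectedMinus : (G : Graph) → Subset (n G) → Set
ConnectedMinus G X =
  ∀ u v → u ∉ X → v ∉ X → Reach G (Data.Fin.Subset.∁ X) u v

Connected : ℕ → Graph → Set
Connected k G = (k ℕ.< n G) × (∀ X → ∣ X ∣ ℕ.< k → ConnectedMinus G X)

-- A cycle of length suc m (≥ 4 when m ≥ 3): distinct vertices c 0, …, c m,
-- consecutive ones adjacent, and c m adjacent to c 0.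
record Cycle (G : Graph) (m : ℕ) : Set where
  field
    vtx     : Fin (suc m) → Fin (n G)
    inj     : Injective _≡_ _≡_ vtx
    edges   : ∀ (i : Fin m) → Adj G (vtx (inject₁ i)) (vtx (suc i))
    closing : Adj G (vtx (fromℕ m)) (vtx zero)

-- a chord: an edge between two cycle vertices that are not consecutive on the cycle
HasChord : (G : Graph) (m : ℕ) → Cycle G m → Set
HasChord G m C =
  Σ (Fin (suc m)) λ i → Σ (Fin (suc m)) λ j →
    (suc (suc (toℕ i)) ℕ.≤ toℕ j) ×
    ¬ (toℕ i ≡ 0 × toℕ j ≡ m) ×
    Adj G (Cycle.vtx C i) (Cycle.vtx C j)

Chordal : Graph → Set
Chordal G = ∀ m → 3 ℕ.≤ m → (C : Cycle G m) → HasChord G m C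

record Clique (G : Graph) (k : ℕ) : Set where
  field
    vtx  : Fin k → Fin (n G)
    inj  : Injective _≡_ _≡_ vtx
    adjc : ∀ i j → i ≢ j → Adj G (vtx i) (vtx j)

Closed : (G : Graph) → (Fin (n G) → ℤ) → Subset (n G) → Set
Closed G θ H = ∀ u → θ u ℤ.≤ + ∣ H ∩ N G u ∣ → u ∈ H

IsHull : (G : Graph) → (Fin (n G) → ℤ) → Subset (n G) → Subset (n G) → Set
IsHull G θ D H =
  D ⊆ H × Closed G θ H × (∀ H' → D ⊆ H' → Closed G θ H' → H ⊆ H')

PartialIncentive : (G : Graph) → (Fin (n G) → ℤ) → (Fin (n G) → ℕ) → Set
PartialIncentive G τ σ =
  Σ (Subset (n G)) λ H → IsHull G (λ u → τ u ℤ.- + σ u) ⊥ H × H ≡ ⊤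

total : (G : Graph) → (Fin (n G) → ℕ) → ℕ
total G σ = sum (tabulate σ)

-- pi(G,τ) ≤ k  (pi is a minimum over partial incentives, which always exist)
PiAtMost : (G : Graph) → (Fin (n G) → ℤ) → ℕ → Set
PiAtMost G τ k = Σ (Fin (n G) → ℕ) λ σ → PartialIncentive G τ σ × total G σ ℕ.≤ k

pos : ℤ → ℕ
pos (+ k)     = k
pos -[1+ _ ]  = 0

module Submission where

open import Defs hiding (sym)

-- The engine is a property of chordal graphs (separated-paths): if u ≠ v are joined by two
-- paths whose interiors lie in vertex sets A and B that are disjoint and joined by no edge,
-- then u and v are adjacent.  By induction on the total length: the two paths form a closed
-- walk, in which a repeated vertex or (by chordality) a chord shortens one of the paths.
-- It yields separator-clique (vertices with neighbours in two such separated connected sets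
-- form a clique) and common-neighbour (a clique outside a connected set C, all of whose
-- vertices have neighbours in C, has a common neighbour in C).  Hence spreading: in a
-- t-connected chordal graph, a set H containing a t-clique and closed under "t neighbours
-- in H" is everything; otherwise a component C of G - H sees a clique of t boundary vertices
-- (the given clique, or the minimal separator cutting off the rest of H), and their common
-- neighbour in C would lie in H.
-- Part (i): a set closed for τ - σ contains v₀, v₁, … in turn and is closed under
-- "t neighbours", so spreading applies.  Part (ii): a t-clique exists (grown one vertex at
-- a time by common-neighbour), and the incentive of part (i) costs at most ∑_{i<t} (t - i).

module Development where

  open import Data.Nat as ℕ using (ℕ; zero; suc; _+_; _∸_; _≤_; _<_; z≤n; s≤s; _≤?_; _<?_)
  open import Data.Nat.Properties
  open import Data.Nat.Combinatorics using (nC1≡n; nCk+nC[k+1]≡[n+1]C[k+1]) renaming (_C_ to _choose_)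
  open import Data.Integer as ℤ using (ℤ; +_; -[1+_]; _⊖_; -≤+; -≤-; +≤+)
  import Data.Integer.Properties as ℤ
  open import Data.Integer.Tactic.RingSolver using (solve-∀)
  open import Data.Bool using (true)
  open import Data.Bool.Properties using () renaming (_≟_ to _≟ᵇ_)
  open import Data.Fin as Fin using (Fin; zero; suc; toℕ)
  open import Data.Fin.Properties
    using (any?; all?; ¬∀⟶∃¬; toℕ-inject₁; toℕ-fromℕ; toℕ-injective; toℕ<n; toℕ-inject)
    renaming (_≟_ to _≟ᶠ_; suc-injective to Fin-suc-injective)
  open import Data.Fin.Subset
    using (Subset; _∈_; _∉_; _⊆_; _∩_; _∪_; _─_; _-_; ∁; ∣_∣; ⁅_⁆; inside; outside)
    renaming (⊥ to ∅; ⊤ to full)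
  open import Data.Fin.Subset.Properties
    using (_∈?_; ∈⊤; ⊥⊆; x∈⁅x⁆; x∈p∩q⁺; x∈p∪q⁺; x∈∁p⇒x∉p; x∉p⇒x∈∁p; x∈p∧x≢y⇒x∈p-y; p─q⊆p;
           p⊆q⇒∣p∣≤∣q∣; ∣p∣≤∣x∷p∣; ∣⊥∣≡0; ∣⊤∣≡n; ∣⁅x⁆∣≡1; ∣p─q∣≤∣p∣; x∈p⇒∣p-x∣<∣p∣)
  import Data.Vec as Vec
  open import Data.Vec using (_∷_; []; tabulate; sum)
  open import Data.Vec.Properties using (lookup⇒[]=; []=⇒lookup; lookup∘tabulate; tabulate-cong)
  open import Data.Vec.Functional using (updateAt)
  open import Data.Vec.Functional.Properties using (updateAt-updates; updateAt-minimal)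
  open import Data.List as List using (List; []; _∷_)
  open import Data.List.Relation.Unary.Any using (here; there)
  open import Data.List.Membership.Propositional using () renaming (_∈_ to _∈ₗ_)
  open import Data.List.Membership.Propositional.Properties
    using (∈-tabulate⁺; ∈-tabulate⁻; ∈-filter⁺; ∈-filter⁻; ∈-allFin)
  open import Data.Product using (Σ; ∃; ∃₂; _×_; _,_; proj₁; proj₂)
  open import Data.Sum using (_⊎_; inj₁; inj₂)
  open import Data.Empty using (⊥; ⊥-elim)
  open import Function using (_∘_)
  open import Function.Definitions using (Injective)
  open import Relation.Nullary using (¬_; Dec; yes; no; does; contradiction)
  open import Relation.Nullary.Decidable using (dec-true; decidable-stable; _×-dec_; ¬?)
  open import Relation.Binary.Definitions using (DecidableEquality; tri<; tri≈; tri>)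
  open import Relation.Binary.PropositionalEquality
    using (_≡_; _≢_; refl; sym; trans; cong; cong₂; subst; subst₂; ≢-sym; module ≡-Reasoning)

  from-does : ∀ {P : Set} (P? : Dec P) → does P? ≡ true → P
  from-does (yes p) _ = p
  from-does (no _) ()

  ⟦_⟧ : ∀ {m} {P : Fin m → Set} → (∀ x → Dec (P x)) → Subset m
  ⟦ P? ⟧ = tabulate (λ x → does (P? x))

  ∈⟦⟧⁺ : ∀ {m} {P : Fin m → Set} (P? : ∀ x → Dec (P x)) {x} → P x → x ∈ ⟦ P? ⟧
  ∈⟦⟧⁺ P? {x} p = lookup⇒[]= x _ (trans (lookup∘tabulate _ x) (dec-true (P? x) p))

  ∈⟦⟧⁻ : ∀ {m} {P : Fin m → Set} (P? : ∀ x → Dec (P x)) {x} → x ∈ ⟦ P? ⟧ → P x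
  ∈⟦⟧⁻ P? {x} x∈ = from-does (P? x) (trans (sym (lookup∘tabulate _ x)) ([]=⇒lookup x∈))

  ∈─⇒∉ : ∀ {m} {x : Fin m} (p q : Subset m) → x ∈ p ─ q → x ∉ q
  ∈─⇒∉ (_ ∷ p) (inside ∷ q) (Vec.there x∈) (Vec.there x∈q) = ∈─⇒∉ p q x∈ x∈q
  ∈─⇒∉ (_ ∷ p) (outside ∷ q) (Vec.there x∈) (Vec.there x∈q) = ∈─⇒∉ p q x∈ x∈q
  ∈─⇒∉ (inside ∷ p) (outside ∷ q) Vec.here ()

  x∈p-y⇒x≢y : ∀ {m} {x y : Fin m} (p : Subset m) → x ∈ p - y → x ≢ y
  x∈p-y⇒x≢y p x∈ refl = ∈─⇒∉ p ⁅ _ ⁆ x∈ (x∈⁅x⁆ _)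

  ∣p∪q∣≤∣p∣+∣q∣ : ∀ {m} (p q : Subset m) → ∣ p ∪ q ∣ ≤ ∣ p ∣ + ∣ q ∣
  ∣p∪q∣≤∣p∣+∣q∣ [] [] = z≤n
  ∣p∪q∣≤∣p∣+∣q∣ (inside ∷ p) (b ∷ q) =
    s≤s (≤-trans (∣p∪q∣≤∣p∣+∣q∣ p q) (+-monoʳ-≤ ∣ p ∣ (∣p∣≤∣x∷p∣ b q)))
  ∣p∪q∣≤∣p∣+∣q∣ (outside ∷ p) (inside ∷ q) =
    subst (suc ∣ p ∪ q ∣ ≤_) (sym (+-suc ∣ p ∣ ∣ q ∣)) (s≤s (∣p∪q∣≤∣p∣+∣q∣ p q))
  ∣p∪q∣≤∣p∣+∣q∣ (outside ∷ p) (outside ∷ q) = ∣p∪q∣≤∣p∣+∣q∣ p q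

  injective⇒≤∣∣ : ∀ {k m} (X : Subset m) (f : Fin k → Fin m) →
                  Injective _≡_ _≡_ f → (∀ i → f i ∈ X) → k ≤ ∣ X ∣
  injective⇒≤∣∣ {zero} X f f-inj f∈X = z≤n
  injective⇒≤∣∣ {suc k} X f f-inj f∈X =
    ≤-trans (s≤s (injective⇒≤∣∣ (X - f zero) (f ∘ suc) (λ e → Fin-suc-injective (f-inj e)) rest))
            (x∈p⇒∣p-x∣<∣p∣ (f∈X zero))
    where
      rest : ∀ i → f (suc i) ∈ X - f zero
      rest i = x∈p∧x≢y⇒x∈p-y (f∈X (suc i)) (λ e → contradiction (f-inj e) λ ())

  image-cover : ∀ {k m} (f : Fin k → Fin m) → Σ (Subset m) λ X → (∀ i → f i ∈ X) × ∣ X ∣ ≤ k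
  image-cover {zero} {m} f = ∅ , (λ ()) , ≤-reflexive (∣⊥∣≡0 m)
  image-cover {suc k} f with image-cover (f ∘ suc)
  ... | X , f∈X , ∣X∣≤k = ⁅ f zero ⁆ ∪ X , covers , size
    where
      covers : ∀ i → f i ∈ ⁅ f zero ⁆ ∪ X
      covers zero = x∈p∪q⁺ (inj₁ (x∈⁅x⁆ (f zero)))
      covers (suc i) = x∈p∪q⁺ (inj₂ (f∈X i))
      size : ∣ ⁅ f zero ⁆ ∪ X ∣ ≤ suc k
      size = ≤-trans (∣p∪q∣≤∣p∣+∣q∣ ⁅ f zero ⁆ X)
                     (subst (λ a → a + ∣ X ∣ ≤ suc k) (sym (∣⁅x⁆∣≡1 (f zero))) (s≤s ∣X∣≤k))

  small⇒missing : ∀ {m} (X : Subset m) → ∣ X ∣ < m → ∃ λ w → w ∉ X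
  small⇒missing {m} X ∣X∣<m with any? (λ w → ¬? (w ∈? X))
  ... | yes missing = missing
  ... | no none = contradiction (subst (_≤ ∣ X ∣) (∣⊤∣≡n m) (p⊆q⇒∣p∣≤∣q∣ full⊆X)) (<⇒≱ ∣X∣<m)
    where
      full⊆X : full ⊆ X
      full⊆X {w} _ = decidable-stable (w ∈? X) (λ w∉X → none (w , w∉X))

  elements : ∀ {m} → Subset m → List (Fin m)
  elements X = List.filter (_∈? X) (List.allFin _)

  ∈elements⁺ : ∀ {m} (X : Subset m) {x} → x ∈ X → x ∈ₗ elements X
  ∈elements⁺ X {x} x∈X = ∈-filter⁺ (_∈? X) (∈-allFin x) x∈X

  ∈elements⁻ : ∀ {m} (X : Subset m) {x} → x ∈ₗ elements X → x ∈ X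
  ∈elements⁻ X x∈ = proj₂ (∈-filter⁻ (_∈? X) {xs = List.allFin _} x∈)

  injective-or-collision : ∀ {k} {B : Set} → DecidableEquality B → (f : Fin k → B) →
                           Injective _≡_ _≡_ f ⊎ ∃₂ λ i j → toℕ i < toℕ j × f i ≡ f j
  injective-or-collision _≟_ f with any? (λ i → any? (λ j → (toℕ i <? toℕ j) ×-dec (f i ≟ f j)))
  ... | yes (i , j , collision) = inj₂ (i , j , collision)
  ... | no none = inj₁ injective
    where
      injective : Injective _≡_ _≡_ f
      injective {i} {j} e with <-cmp (toℕ i) (toℕ j)
      ... | tri< i<j _ _ = ⊥-elim (none (i , j , i<j , e))
      ... | tri≈ _ i≡j _ = toℕ-injective i≡j
      ... | tri> _ _ j<i = ⊥-elim (none (j , i , j<i , sym e))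

  first-index : (P : ℕ → Set) → (∀ k → Dec (P k)) → ∀ M → P M →
                Σ ℕ λ m → m ≤ M × P m × (∀ k → k < m → ¬ P k)
  first-index P P? zero p = 0 , z≤n , p , λ _ ()
  first-index P P? (suc M) p with P? 0
  ... | yes p₀ = 0 , z≤n , p₀ , λ _ ()
  ... | no ¬p₀ with first-index (P ∘ suc) (P? ∘ suc) M p
  ...   | m , m≤M , pm , before = suc m , s≤s m≤M , pm , λ { zero _ → ¬p₀ ; (suc k) k<m → before k (≤-pred k<m) }

  last-index : (P : ℕ → Set) → (∀ k → Dec (P k)) → P 0 → ∀ M →
               Σ ℕ λ j → j ≤ M × P j × (∀ k → j < k → k ≤ M → ¬ P k)
  last-index P P? p₀ zero = 0 , z≤n , p₀ , λ k 0<k k≤0 _ → <⇒≱ 0<k k≤0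
  last-index P P? p₀ (suc M) with P? (suc M)
  ... | yes p = suc M , ≤-refl , p , λ k j<k k≤j _ → <⇒≱ j<k k≤j
  ... | no ¬p with last-index P P? p₀ M
  ...   | j , j≤M , pj , after = j , m≤n⇒m≤1+n j≤M , pj , after′
    where
      after′ : ∀ k → j < k → k ≤ suc M → ¬ P k
      after′ k j<k k≤1+M with k ≟ suc M
      ... | yes refl = ¬p
      ... | no k≢1+M = after k j<k (≤-pred (≤∧≢⇒< k≤1+M k≢1+M))

  sum-zero : ∀ {m} (σ : Fin m → ℕ) → (∀ u → σ u ≡ 0) → sum (tabulate σ) ≡ 0
  sum-zero {zero} σ σ≡0 = refl
  sum-zero {suc m} σ σ≡0 = cong₂ _+_ (σ≡0 zero) (sum-zero (σ ∘ suc) (σ≡0 ∘ suc))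

  sum-mono : ∀ {m} (σ σ′ : Fin m → ℕ) → (∀ u → σ u ≤ σ′ u) → sum (tabulate σ) ≤ sum (tabulate σ′)
  sum-mono {zero} σ σ′ σ≤σ′ = z≤n
  sum-mono {suc m} σ σ′ σ≤σ′ = +-mono-≤ (σ≤σ′ zero) (sum-mono (σ ∘ suc) (σ′ ∘ suc) (σ≤σ′ ∘ suc))

  sum-split : ∀ {m} (σ : Fin m → ℕ) (v : Fin m) →
              sum (tabulate σ) ≡ σ v + sum (tabulate (updateAt σ v (λ _ → 0)))
  sum-split σ zero = refl
  sum-split σ (suc v) = begin
    σ zero + sum (tabulate (σ ∘ suc))          ≡⟨ cong (_+_ (σ zero)) (sum-split (σ ∘ suc) v) ⟩
    σ zero + (σ (suc v) + rest)                ≡⟨ sym (+-assoc (σ zero) _ rest) ⟩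
    σ zero + σ (suc v) + rest                  ≡⟨ cong (_+ rest) (+-comm (σ zero) (σ (suc v))) ⟩
    σ (suc v) + σ zero + rest                  ≡⟨ +-assoc (σ (suc v)) _ rest ⟩
    σ (suc v) + (σ zero + rest)                ∎
    where
      open ≡-Reasoning
      rest : ℕ
      rest = sum (tabulate (updateAt (σ ∘ suc) v (λ _ → 0)))

  sum-supported : ∀ {k m} (f : Fin k → Fin m) → Injective _≡_ _≡_ f → (σ : Fin m → ℕ) →
                  (∀ u → (∀ i → u ≢ f i) → σ u ≡ 0) →
                  sum (tabulate σ) ≡ sum (tabulate (σ ∘ f))
  sum-supported {zero} f f-inj σ vanish = sum-zero σ (λ u → vanish u λ ())
  sum-supported {suc k} f f-inj σ vanish = begin
    sum (tabulate σ)                             ≡⟨ sum-split σ (f zero) ⟩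
    σ (f zero) + sum (tabulate σ₀)               ≡⟨ cong (_+_ (σ (f zero))) (sum-supported (f ∘ suc) inj′ σ₀ vanish₀) ⟩
    σ (f zero) + sum (tabulate (σ₀ ∘ f ∘ suc))   ≡⟨ cong (λ s → σ (f zero) + sum s) (tabulate-cong unchanged) ⟩
    σ (f zero) + sum (tabulate (σ ∘ f ∘ suc))    ∎
    where
      open ≡-Reasoning
      σ₀ : Fin _ → ℕ
      σ₀ = updateAt σ (f zero) (λ _ → 0)
      inj′ : Injective _≡_ _≡_ (f ∘ suc)
      inj′ e = Fin-suc-injective (f-inj e)
      vanish₀ : ∀ u → (∀ i → u ≢ f (suc i)) → σ₀ u ≡ 0
      vanish₀ u u∉ with u ≟ᶠ f zero
      ... | yes refl = updateAt-updates (f zero) σ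
      ... | no u≢f₀ = trans (updateAt-minimal u (f zero) σ u≢f₀) (vanish u λ { zero → u≢f₀ ; (suc i) → u∉ i })
      unchanged : ∀ i → σ₀ (f (suc i)) ≡ σ (f (suc i))
      unchanged i = updateAt-minimal (f (suc i)) (f zero) σ (λ e → contradiction (f-inj e) λ ())

  triangular : ∀ t → sum (tabulate (λ (i : Fin t) → t ∸ toℕ i)) ≡ suc t choose 2
  triangular zero = refl
  triangular (suc t) = begin
    suc t + sum (tabulate (λ (i : Fin t) → t ∸ toℕ i)) ≡⟨ cong (_+_ (suc t)) (triangular t) ⟩
    suc t + suc t choose 2                             ≡⟨ cong (_+ suc t choose 2) (sym (nC1≡n (suc t))) ⟩
    suc t choose 1 + suc t choose 2                    ≡⟨ nCk+nC[k+1]≡[n+1]C[k+1] (suc t) 1 ⟩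
    suc (suc t) choose 2                               ∎
    where open ≡-Reasoning

  ≤-pos : ∀ x → x ℤ.≤ + pos x
  ≤-pos (+ _) = ℤ.≤-refl
  ≤-pos -[1+ _ ] = -≤+

  pos-mono : ∀ {x y} → x ℤ.≤ y → pos x ≤ pos y
  pos-mono (-≤- _) = z≤n
  pos-mono -≤+ = z≤n
  pos-mono (+≤+ a≤b) = a≤b

  pos-⊖ : ∀ a b → pos (a ⊖ b) ≡ a ∸ b
  pos-⊖ zero zero = refl
  pos-⊖ zero (suc b) = refl
  pos-⊖ (suc a) zero = refl
  pos-⊖ (suc a) (suc b) = trans (cong pos (ℤ.[1+m]⊖[1+n]≡m⊖n a b)) (pos-⊖ a b)

  incentive-residual : ∀ τ k → τ ℤ.- + pos (τ ℤ.- + k) ℤ.≤ + k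
  incentive-residual τ k = ℤ.≤-trans (ℤ.+-monoʳ-≤ τ (ℤ.neg-mono-≤ (≤-pos (τ ℤ.- + k))))
                                     (ℤ.≤-reflexive (cancel τ (+ k)))
    where
      cancel : ∀ i j → i ℤ.- (i ℤ.- j) ≡ j
      cancel = solve-∀

  incentive-bound : ∀ τ k t → τ ℤ.≤ + t → pos (τ ℤ.- + k) ≤ t ∸ k
  incentive-bound τ k t τ≤t =
    subst (pos (τ ℤ.- + k) ≤_) (trans (cong pos (ℤ.[+m]-[+n]≡m⊖n t k)) (pos-⊖ t k))
          (pos-mono (ℤ.+-monoˡ-≤ (ℤ.- + k) τ≤t))

  module GraphFacts (G : Graph) where

    V : Set
    V = Fin (n G)

    adj-sym : ∀ {u v} → Adj G u v → Adj G v u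
    adj-sym {u} {v} a = trans (Graph.sym G v u) a

    adj⇒≢ : ∀ {u v} → Adj G u v → u ≢ v
    adj⇒≢ {u} a refl with trans (sym (irrefl G u)) a
    ... | ()

    adj? : ∀ u v → Dec (Adj G u v)
    adj? u v = adj G u v ≟ᵇ true

    ∈N : ∀ {u v} → Adj G u v → v ∈ N G u
    ∈N {u} {v} a = lookup⇒[]= v _ (trans (lookup∘tabulate (adj G u) v) a)

    Touches : Subset (n G) → V → Set
    Touches C s = ∃ λ c → c ∈ C × Adj G s c

    Linked : Subset (n G) → Set
    Linked C = ∀ {a b} → a ∈ C → b ∈ C → Reach G C a b

    module _ {k} (K : Clique G k) where
      open Clique K

      members : List V
      members = List.tabulate vtx

      every-member : ∀ {P : V → Set} → (∀ i → P (vtx i)) → ∀ {s} → s ∈ₗ members → P s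
      every-member P-vtx s∈K with ∈-tabulate⁻ s∈K
      ... | i , refl = P-vtx i

      members-clique : ∀ {s s′} → s ∈ₗ members → s′ ∈ₗ members → s ≢ s′ → Adj G s s′
      members-clique s∈K s′∈K s≢s′ with ∈-tabulate⁻ s∈K | ∈-tabulate⁻ s′∈K
      ... | i , refl | j , refl = adjc i j (λ i≡j → s≢s′ (cong vtx i≡j))

    module _ {S : Subset (n G)} where

      reach-head : ∀ {u v} → Reach G S u v → u ∈ S
      reach-head (here u∈S) = u∈S
      reach-head (step u∈S _ _) = u∈S

      reach-last : ∀ {u v} → Reach G S u v → v ∈ S
      reach-last (here u∈S) = u∈S
      reach-last (step _ _ r) = reach-last r

      reach-snoc : ∀ {u v x} → Reach G S u v → Adj G v x → x ∈ S → Reach G S u x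
      reach-snoc (here u∈S) a x∈S = step u∈S a (here x∈S)
      reach-snoc (step u∈S a′ r) a x∈S = step u∈S a′ (reach-snoc r a x∈S)

      reach-++ : ∀ {u v w} → Reach G S u v → Reach G S v w → Reach G S u w
      reach-++ (here _) r′ = r′
      reach-++ (step u∈S a r) r′ = step u∈S a (reach-++ r r′)

      reach-sym : ∀ {u v} → Reach G S u v → Reach G S v u
      reach-sym (here u∈S) = here u∈S
      reach-sym (step u∈S a r) = reach-snoc (reach-sym r) (adj-sym a) u∈S

      reach-preserves : (U : V → Set) → (∀ {x y} → U x → Adj G x y → y ∈ S → U y) →
                        ∀ {u v} → Reach G S u v → U u → U v
      reach-preserves U step-U (here _) Uu = Uu
      reach-preserves U step-U (step _ a r) Uu = reach-preserves U step-U r (step-U Uu a (reach-head r))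

      first-step : ∀ {u v} → Reach G S u v → u ≢ v → ∃ λ y → Adj G u y × y ∈ S
      first-step (here _) u≢v = ⊥-elim (u≢v refl)
      first-step (step _ a r) _ = _ , a , reach-head r

    last-visit : ∀ {S : Subset (n G)} {w v} → Reach G S w v → (u : V) →
                 Reach G (S - u) w v ⊎ (∃ λ x → Adj G u x × Reach G (S - u) x v) ⊎ u ≡ v
    last-visit {w = w} (here w∈S) u with w ≟ᶠ u
    ... | yes refl = inj₂ (inj₂ refl)
    ... | no w≢u = inj₁ (here (x∈p∧x≢y⇒x∈p-y w∈S w≢u))
    last-visit {w = w} (step {w = x} w∈S a r) u with last-visit r u
    ... | inj₂ later = inj₂ later
    ... | inj₁ r′ with w ≟ᶠ u
    ...   | yes refl = inj₂ (inj₁ (x , a , r′))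
    ...   | no w≢u = inj₁ (step (x∈p∧x≢y⇒x∈p-y w∈S w≢u) a r′)

    leave-start : ∀ {S : Subset (n G)} {u v} → Reach G S u v → u ≢ v → ∃ λ x → Adj G u x × Reach G (S - u) x v
    leave-start {S} {u} r u≢v with last-visit r u
    ... | inj₁ r′ = ⊥-elim (x∈p-y⇒x≢y S (reach-head r′) refl)
    ... | inj₂ (inj₁ leave) = leave
    ... | inj₂ (inj₂ u≡v) = ⊥-elim (u≢v u≡v)

    reach-mono : ∀ {S S′ : Subset (n G)} → S ⊆ S′ → ∀ {u v} → Reach G S u v → Reach G S′ u v
    reach-mono S⊆S′ (here u∈S) = here (S⊆S′ u∈S)
    reach-mono S⊆S′ (step u∈S a r) = step (S⊆S′ u∈S) a (reach-mono S⊆S′ r)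

    reach-bounded? : ∀ k (S : Subset (n G)) → ∣ S ∣ ≤ k → ∀ u v → Dec (Reach G S u v)
    reach-bounded? k S ∣S∣≤k u v with u ∈? S | u ≟ᶠ v
    ... | no u∉S | _ = no (u∉S ∘ reach-head)
    ... | yes u∈S | yes refl = yes (here u∈S)
    ... | yes u∈S | no u≢v with k
    ...   | zero = ⊥-elim (<⇒≱ (x∈p⇒∣p-x∣<∣p∣ u∈S) (≤-trans ∣S∣≤k z≤n))
    ...   | suc k′ with any? (λ x → adj? u x ×-dec reach-bounded? k′ (S - u) (≤-pred (≤-trans (x∈p⇒∣p-x∣<∣p∣ u∈S) ∣S∣≤k)) x v)
    ...     | yes (x , a , r) = yes (step u∈S a (reach-mono (p─q⊆p S ⁅ u ⁆) r))
    ...     | no none = no (λ r → none (leave-start r u≢v))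

    reach? : ∀ (S : Subset (n G)) u v → Dec (Reach G S u v)
    reach? S = reach-bounded? ∣ S ∣ S ≤-refl

    -- The component of w in the subgraph induced by S (empty if w ∉ S).
    module Component (S : Subset (n G)) (w : V) where

      vertices : Subset (n G)
      vertices = ⟦ reach? S w ⟧

      reach⇒∈ : ∀ {v} → Reach G S w v → v ∈ vertices
      reach⇒∈ = ∈⟦⟧⁺ (reach? S w)

      ∈⇒reach : ∀ {v} → v ∈ vertices → Reach G S w v
      ∈⇒reach = ∈⟦⟧⁻ (reach? S w)

      ⊆ambient : ∀ {v} → v ∈ vertices → v ∈ S
      ⊆ambient = reach-last ∘ ∈⇒reach

      grows : ∀ {v x} → v ∈ vertices → Adj G v x → x ∈ S → x ∈ vertices
      grows v∈ a x∈S = reach⇒∈ (reach-snoc (∈⇒reach v∈) a x∈S)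

      linked : Linked vertices
      linked a∈ b∈ = restrict (∈⇒reach a∈) (reach-++ (reach-sym (∈⇒reach a∈)) (∈⇒reach b∈))
        where
          restrict : ∀ {a b} → Reach G S w a → Reach G S a b → Reach G vertices a b
          restrict wa (here _) = here (reach⇒∈ wa)
          restrict wa (step _ a r) = step (reach⇒∈ wa) a (restrict (reach-snoc wa a (reach-head r)) r)

  -- Walks and paths given by their sequence of vertices: the form in which cycles are built.
  module IndexedWalks (G : Graph) where
    open GraphFacts G

    Links : (ℕ → V) → ℕ → Set
    Links f ℓ = ∀ k → k < ℓ → Adj G (f k) (f (suc k))

    record Walk (A : V → Set) (u v : V) : Set where
      field
        len    : ℕ
        at     : ℕ → V
        start  : at 0 ≡ u
        end    : at len ≡ v
        links  : Links at len
        every : ∀ k → k ≤ len → A (at k)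

    record Path (A : V → Set) (u v : V) : Set where
      field
        len      : ℕ
        at       : ℕ → V
        start    : at 0 ≡ u
        end      : at len ≡ v
        links    : Links at len
        interior : ∀ k → 0 < k → k < len → A (at k)

    walk : ∀ {S u v} → Reach G S u v → Walk (_∈ S) u v
    walk {u = u} (here u∈S) = record
      { len = 0 ; at = λ _ → u ; start = refl ; end = refl
      ; links = λ _ () ; every = λ { _ z≤n → u∈S } }
    walk {u = u} (step u∈S ua r) = record
      { len = suc len ; at = at′ ; start = refl ; end = end
      ; links = λ { zero _ → subst (Adj G u) (sym start) ua ; (suc k) k<ℓ → links k (≤-pred k<ℓ) }
      ; every = λ { zero _ → u∈S ; (suc k) k≤ℓ → every k (≤-pred k≤ℓ) } }
      where
        open Walk (walk r)
        at′ : ℕ → V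
        at′ zero = u
        at′ (suc k) = at k

    stay : ∀ {A : V → Set} {a} → A a → Walk A a a
    stay {a = a} Aa = record
      { len = 0 ; at = λ _ → a ; start = refl ; end = refl
      ; links = λ _ () ; every = λ { _ z≤n → Aa } }

    take : ∀ {A u v} (w : Walk A u v) (i : ℕ) → i ≤ Walk.len w → Walk A u (Walk.at w i)
    take w i i≤len = record
      { len = i ; at = at ; start = start ; end = refl
      ; links = λ k k<i → links k (<-≤-trans k<i i≤len)
      ; every = λ k k≤i → every k (≤-trans k≤i i≤len) }
      where open Walk w

    drop : ∀ {A B u v} (w : Walk A u v) (i : ℕ) → i ≤ Walk.len w →
           (∀ k → i ≤ k → k ≤ Walk.len w → B (Walk.at w k)) → Walk B (Walk.at w i) v
    drop w i i≤len B-from-i = record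
      { len = len ∸ i ; at = λ k → at (i + k)
      ; start = cong at (+-identityʳ i)
      ; end = trans (cong at (m+[n∸m]≡n i≤len)) end
      ; links = λ k k<rest → subst (λ j → Adj G (at (i + k)) (at j)) (sym (+-suc i k))
                                   (links (i + k) (<-≤-trans (+-monoʳ-< i k<rest) i+rest≤len))
      ; every = λ k k≤rest → B-from-i (i + k) (m≤m+n i k) (≤-trans (+-monoʳ-≤ i k≤rest) i+rest≤len) }
      where
        open Walk w
        i+rest≤len : i + (len ∸ i) ≤ len
        i+rest≤len = ≤-reflexive (m+[n∸m]≡n i≤len)

    bracket : V → (ℕ → V) → ℕ → V → ℕ → V
    bracket u f ℓ v zero = u
    bracket u f ℓ v (suc k) with k ≤? ℓ
    ... | yes _ = f k
    ... | no _ = v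

    bracket-middle : ∀ u f ℓ v k → k ≤ ℓ → bracket u f ℓ v (suc k) ≡ f k
    bracket-middle u f ℓ v k k≤ℓ with k ≤? ℓ
    ... | yes _ = refl
    ... | no k≰ℓ = ⊥-elim (k≰ℓ k≤ℓ)

    bracket-end : ∀ u f ℓ v → bracket u f ℓ v (suc (suc ℓ)) ≡ v
    bracket-end u f ℓ v with suc ℓ ≤? ℓ
    ... | yes 1+ℓ≤ℓ = ⊥-elim (<-irrefl refl 1+ℓ≤ℓ)
    ... | no _ = refl

    detour : ∀ {A u a b v} → Adj G u a → Walk A a b → Adj G b v → Path A u v
    detour {A} {u} {v = v} ua w bv = record
      { len = suc (suc len) ; at = bracket u at len v ; start = refl ; end = bracket-end u at len v
      ; links = links′ ; interior = interior′ }
      where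
        open Walk w
        middle : ∀ k → k ≤ len → bracket u at len v (suc k) ≡ at k
        middle = bracket-middle u at len v
        links′ : Links (bracket u at len v) (suc (suc len))
        links′ zero _ = subst (Adj G u) (sym (trans (middle 0 z≤n) start)) ua
        links′ (suc k) k<ℓ with k ≟ len
        ... | yes refl = subst₂ (Adj G) (sym (trans (middle k ≤-refl) end)) (sym (bracket-end u at len v)) bv
        ... | no k≢len = subst₂ (Adj G) (sym (middle k (≤-pred (≤-pred k<ℓ)))) (sym (middle (suc k) k<len)) (links k k<len)
          where
            k<len : k < len
            k<len = ≤∧≢⇒< (≤-pred (≤-pred k<ℓ)) k≢len
        interior′ : ∀ k → 0 < k → k < suc (suc len) → A (bracket u at len v k)
        interior′ (suc k) _ k<ℓ = subst A (sym (middle k (≤-pred (≤-pred k<ℓ)))) (every k (≤-pred (≤-pred k<ℓ)))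

  module SeparatedPaths (G : Graph) (chordal : Chordal G) where
    open GraphFacts G
    open IndexedWalks G
    open Path

    Separated : (A B : V → Set) → Set
    Separated A B = ∀ {x y} → A x → B y → x ≢ y × ¬ Adj G x y

    Shorter : ∀ {A u v} → Path A u v → Set
    Shorter {A} {u} {v} p = Σ (Path A u v) λ p′ → len p′ < len p

    length-cases : ∀ {A u v} (p : Path A u v) → u ≡ v ⊎ Adj G u v ⊎ 2 ≤ len p
    length-cases p with len p in len≡
    ... | zero = inj₁ (trans (sym (start p)) (trans (cong (at p) (sym len≡)) (end p)))
    ... | suc zero = inj₂ (inj₁ (subst₂ (Adj G) (start p) (trans (cong (at p) (sym len≡)) (end p))
                                        (links p 0 (subst (0 <_) (sym len≡) (s≤s z≤n)))))
    ... | suc (suc _) = inj₂ (inj₂ (s≤s (s≤s z≤n)))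

    cut : ∀ {A u v} (p : Path A u v) (x : ℕ) → x < len p → at p x ≡ v → Shorter p
    cut p x x<len x-is-end =
      record { len = x ; at = at p ; start = start p ; end = x-is-end
             ; links = λ k k<x → links p k (<-trans k<x x<len)
             ; interior = λ k 0<k k<x → interior p k 0<k (<-trans k<x x<len) } , x<len

    skip : (ℕ → V) → ℕ → ℕ → ℕ → V
    skip f x d k with k ≤? x
    ... | yes _ = f k
    ... | no _ = f (k + d)

    skip-before : ∀ f x d k → k ≤ x → skip f x d k ≡ f k
    skip-before f x d k k≤x with k ≤? x
    ... | yes _ = refl
    ... | no k≰x = ⊥-elim (k≰x k≤x)

    skip-after : ∀ f x d k → x < k → skip f x d k ≡ f (k + d)
    skip-after f x d k x<k with k ≤? x
    ... | yes k≤x = ⊥-elim (<⇒≱ x<k k≤x)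
    ... | no _ = refl

    bypass : ∀ {A u v} (p : Path A u v) (x z : ℕ) → 2 + x ≤ z → z ≤ len p → Adj G (at p x) (at p z) → Shorter p
    bypass {A} p x z 2+x≤z z≤len xz =
      record { len = len p ∸ d ; at = skip (at p) x d
             ; start = trans (skip-before (at p) x d 0 z≤n) (start p)
             ; end = trans (skip-after (at p) x d (len p ∸ d) x<len′) (trans (cong (at p) (m∸n+n≡m d≤len)) (end p))
             ; links = links′ ; interior = interior′ } , ∸-monoʳ-< (m<n⇒0<n∸m 2+x≤z) d≤len
      where
        d : ℕ
        d = z ∸ suc x
        1+x+d≡z : suc x + d ≡ z
        1+x+d≡z = m+[n∸m]≡n (<⇒≤ 2+x≤z)
        1+x+d≤len : suc x + d ≤ len p
        1+x+d≤len = subst (_≤ len p) (sym 1+x+d≡z) z≤len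
        x<len : x < len p
        x<len = ≤-trans (m≤m+n (suc x) d) 1+x+d≤len
        d≤len : d ≤ len p
        d≤len = ≤-trans (m≤n+m d (suc x)) 1+x+d≤len
        x<len′ : x < len p ∸ d
        x<len′ = subst (_≤ len p ∸ d) (m+n∸n≡m (suc x) d) (∸-monoˡ-≤ d 1+x+d≤len)
        shifted : ∀ {k} → k < len p ∸ d → k + d < len p
        shifted {k} k<len′ = subst (k + d <_) (m∸n+n≡m d≤len) (+-monoˡ-< d k<len′)
        links′ : Links (skip (at p) x d) (len p ∸ d)
        links′ k k<len′ with <-cmp k x
        ... | tri< k<x _ _ = subst₂ (Adj G) (sym (skip-before (at p) x d k (<⇒≤ k<x)))
                                    (sym (skip-before (at p) x d (suc k) k<x)) (links p k (<-trans k<x x<len))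
        ... | tri≈ _ refl _ = subst₂ (Adj G) (sym (skip-before (at p) x d x ≤-refl))
                                     (sym (trans (skip-after (at p) x d (suc x) ≤-refl) (cong (at p) 1+x+d≡z))) xz
        ... | tri> _ _ x<k = subst₂ (Adj G) (sym (skip-after (at p) x d k x<k))
                                    (sym (skip-after (at p) x d (suc k) (m<n⇒m<1+n x<k))) (links p (k + d) (shifted k<len′))
        interior′ : ∀ k → 0 < k → k < len p ∸ d → A (skip (at p) x d k)
        interior′ k 0<k k<len′ with k ≤? x
        ... | yes k≤x = interior p k 0<k (≤-<-trans k≤x x<len)
        ... | no _ = interior p (k + d) (<-≤-trans 0<k (m≤m+n k d)) (shifted k<len′)

    repeat : ∀ {A u v} (p : Path A u v) (x y : ℕ) → x < y → y ≤ len p → at p x ≡ at p y → Shorter p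
    repeat p x y x<y y≤len same with y ≟ len p
    ... | yes refl = cut p x x<y (trans same (end p))
    ... | no y≢len = bypass p x (suc y) (s≤s x<y) y<len (subst (λ a → Adj G a (at p (suc y))) (sym same) (links p y y<len))
      where
        y<len : y < len p
        y<len = ≤∧≢⇒< y≤len y≢len

    -- The closed walk p followed by q, of length m = len p + b where len q = b + 1.
    -- A repeated vertex or (by chordality) a chord shortens p or q; a coincidence or an
    -- edge between the interiors of p and q is excluded by separation.
    module ClosedWalk {A B : V → Set} {u v : V} (sep : Separated A B) (p : Path A u v) (q : Path B v u)
                      (b : ℕ) (len-q : len q ≡ suc b) (0<b : 0 < b) (2≤len-p : 2 ≤ len p) where

      ℓ m : ℕ
      ℓ = len p
      m = ℓ + b

      cyc : ℕ → V
      cyc k with k ≤? ℓ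
      ... | yes _ = at p k
      ... | no _ = at q (k ∸ ℓ)

      cyc-p : ∀ k → k ≤ ℓ → cyc k ≡ at p k
      cyc-p k k≤ℓ with k ≤? ℓ
      ... | yes _ = refl
      ... | no k≰ℓ = ⊥-elim (k≰ℓ k≤ℓ)

      cyc-q : ∀ k → ℓ ≤ k → cyc k ≡ at q (k ∸ ℓ)
      cyc-q k ℓ≤k with k ≤? ℓ
      ... | no _ = refl
      ... | yes k≤ℓ with ≤-antisym k≤ℓ ℓ≤k
      ...   | refl = trans (end p) (trans (sym (start q)) (cong (at q) (sym (n∸n≡0 ℓ))))

      cyc-0 : cyc 0 ≡ u
      cyc-0 = trans (cyc-p 0 z≤n) (start p)

      q-index : ∀ {y} → y ≤ m → y ∸ ℓ ≤ b
      q-index y≤m = subst (_ ≤_) (m+n∸m≡n ℓ b) (∸-monoˡ-≤ ℓ y≤m)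

      q-index-< : ∀ {y} → ℓ ≤ y → y < m → y ∸ ℓ < b
      q-index-< ℓ≤y y<m = subst (_ <_) (m+n∸m≡n ℓ b) (∸-monoˡ-< y<m ℓ≤y)

      below-len-q : ∀ {j} → j ≤ b → j < len q
      below-len-q j≤b = subst (_ <_) (sym len-q) (s≤s j≤b)

      cyc-links : Links cyc m
      cyc-links k k<m with ℓ ≤? k
      ... | no ℓ≰k = subst₂ (Adj G) (sym (cyc-p k (<⇒≤ k<ℓ))) (sym (cyc-p (suc k) k<ℓ)) (links p k k<ℓ)
        where
          k<ℓ : k < ℓ
          k<ℓ = ≰⇒> ℓ≰k
      ... | yes ℓ≤k = subst₂ (Adj G) (sym (cyc-q k ℓ≤k))
                             (sym (trans (cyc-q (suc k) (m≤n⇒m≤1+n ℓ≤k)) (cong (at q) (+-∸-assoc 1 ℓ≤k))))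
                             (links q (k ∸ ℓ) (below-len-q (<⇒≤ (q-index-< ℓ≤k k<m))))

      cyc-closing : Adj G (cyc m) (cyc 0)
      cyc-closing = subst₂ (Adj G) (sym (trans (cyc-q m (m≤m+n ℓ b)) (cong (at q) (m+n∸m≡n ℓ b))))
                           (trans (cong (at q) (sym len-q)) (trans (end q) (sym cyc-0)))
                           (links q b (below-len-q ≤-refl))

      vertex : Fin (suc m) → V
      vertex i = cyc (toℕ i)

      cycle : Injective _≡_ _≡_ vertex → Cycle G m
      cycle vertex-inj = record
        { vtx = vertex ; inj = vertex-inj
        ; edges = λ i → subst (λ k → Adj G (cyc k) (cyc (suc (toℕ i)))) (sym (toℕ-inject₁ i)) (cyc-links (toℕ i) (toℕ<n i))
        ; closing = subst (λ k → Adj G (cyc k) (cyc 0)) (sym (toℕ-fromℕ m)) cyc-closing }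

      3≤m : 3 ≤ m
      3≤m = +-mono-≤ 2≤len-p 0<b

      in-p : ∀ x → 0 < x → x < ℓ → A (cyc x)
      in-p x 0<x x<ℓ = subst A (sym (cyc-p x (<⇒≤ x<ℓ))) (interior p x 0<x x<ℓ)

      in-q : ∀ y → ℓ < y → y ≤ m → B (cyc y)
      in-q y ℓ<y y≤m = subst B (sym (cyc-q y (<⇒≤ ℓ<y))) (interior q (y ∸ ℓ) (m<n⇒0<n∸m ℓ<y) (below-len-q (q-index y≤m)))

      data Positions (x y : ℕ) : Set where
        within-p : y ≤ ℓ → Positions x y
        within-q : ℓ ≤ x → Positions x y
        start-q  : x ≡ 0 → ℓ < y → Positions x y
        across   : 0 < x → x < ℓ → ℓ < y → Positions x y

      positions : ∀ x y → Positions x y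
      positions x y with y ≤? ℓ | ℓ ≤? x
      ... | yes y≤ℓ | _ = within-p y≤ℓ
      ... | no _ | yes ℓ≤x = within-q ℓ≤x
      ... | no y≰ℓ | no ℓ≰x with x
      ...   | zero = start-q refl (≰⇒> y≰ℓ)
      ...   | suc _ = across (s≤s z≤n) (≰⇒> ℓ≰x) (≰⇒> y≰ℓ)

      repeat-shortcut : ∀ x y → x < y → y ≤ m → cyc x ≡ cyc y → Shorter p ⊎ Shorter q
      repeat-shortcut x y x<y y≤m same with positions x y
      ... | within-p y≤ℓ = inj₁ (repeat p x y x<y y≤ℓ
              (trans (sym (cyc-p x (≤-trans (<⇒≤ x<y) y≤ℓ))) (trans same (cyc-p y y≤ℓ))))
      ... | within-q ℓ≤x = inj₂ (repeat q (x ∸ ℓ) (y ∸ ℓ) (∸-monoˡ-< x<y ℓ≤x) (<⇒≤ (below-len-q (q-index y≤m)))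
              (trans (sym (cyc-q x ℓ≤x)) (trans same (cyc-q y (≤-trans ℓ≤x (<⇒≤ x<y))))))
      ... | start-q refl ℓ<y = inj₂ (cut q (y ∸ ℓ) (below-len-q (q-index y≤m))
              (trans (sym (cyc-q y (<⇒≤ ℓ<y))) (trans (sym same) cyc-0)))
      ... | across 0<x x<ℓ ℓ<y = ⊥-elim (proj₁ (sep (in-p x 0<x x<ℓ) (in-q y ℓ<y y≤m)) same)

      chord-shortcut : ∀ x y → 2 + x ≤ y → y ≤ m → ¬ (x ≡ 0 × y ≡ m) → Adj G (cyc x) (cyc y) → Shorter p ⊎ Shorter q
      chord-shortcut x y 2+x≤y y≤m not-closing xy with positions x y
      ... | within-p y≤ℓ = inj₁ (bypass p x y 2+x≤y y≤ℓ
              (subst₂ (Adj G) (cyc-p x (≤-trans (m≤n+m x 2) (≤-trans 2+x≤y y≤ℓ))) (cyc-p y y≤ℓ) xy))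
      ... | within-q ℓ≤x = inj₂ (bypass q (x ∸ ℓ) (y ∸ ℓ)
              (subst (_≤ y ∸ ℓ) (+-∸-assoc 2 ℓ≤x) (∸-monoˡ-≤ ℓ 2+x≤y)) (<⇒≤ (below-len-q (q-index y≤m)))
              (subst₂ (Adj G) (cyc-q x ℓ≤x) (cyc-q y (≤-trans ℓ≤x (≤-trans (m≤n+m x 2) 2+x≤y))) xy))
      ... | start-q refl ℓ<y = inj₂ (bypass q (y ∸ ℓ) (len q)
              (subst (_ ≤_) (sym len-q) (s≤s (q-index-< (<⇒≤ ℓ<y) (≤∧≢⇒< y≤m λ y≡m → not-closing (refl , y≡m))))) ≤-refl
              (subst₂ (Adj G) (cyc-q y (<⇒≤ ℓ<y)) (trans cyc-0 (sym (end q))) (adj-sym xy)))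
      ... | across 0<x x<ℓ ℓ<y = ⊥-elim (proj₂ (sep (in-p x 0<x x<ℓ) (in-q y ℓ<y y≤m)) xy)

      shortcut : Shorter p ⊎ Shorter q
      shortcut with injective-or-collision _≟ᶠ_ vertex
      ... | inj₂ (i , j , i<j , same) = repeat-shortcut (toℕ i) (toℕ j) i<j (≤-pred (toℕ<n j)) same
      ... | inj₁ vertex-inj with chordal m 3≤m (cycle vertex-inj)
      ...   | i , j , 2+i≤j , not-closing , ij = chord-shortcut (toℕ i) (toℕ j) 2+i≤j (≤-pred (toℕ<n j)) not-closing ij

    cycle-shortcut : ∀ {A B u v} → Separated A B → (p : Path A u v) (q : Path B v u) →
                     2 ≤ len p → 2 ≤ len q → Shorter p ⊎ Shorter q
    cycle-shortcut sep p q 2≤p 2≤q =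
      ClosedWalk.shortcut sep p q (len q ∸ 1) (sym (m+[n∸m]≡n (≤-trans (s≤s z≤n) 2≤q))) (∸-monoˡ-≤ 1 2≤q) 2≤p

    separated-paths : ∀ {A B u v} → Separated A B → Path A u v → Path B v u → u ≢ v → Adj G u v
    separated-paths {A} {B} {u} {v} sep p₀ q₀ u≢v = go (suc (len p₀ + len q₀)) p₀ q₀ ≤-refl
      where
        go : ∀ fuel (p : Path A u v) (q : Path B v u) → len p + len q < fuel → Adj G u v
        go (suc fuel) p q bound with length-cases p | length-cases q
        ... | inj₁ u≡v | _ = ⊥-elim (u≢v u≡v)
        ... | inj₂ (inj₁ uv) | _ = uv
        ... | inj₂ (inj₂ _) | inj₁ v≡u = ⊥-elim (u≢v (sym v≡u))
        ... | inj₂ (inj₂ _) | inj₂ (inj₁ vu) = adj-sym vu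
        ... | inj₂ (inj₂ 2≤p) | inj₂ (inj₂ 2≤q) with cycle-shortcut sep p q 2≤p 2≤q
        ...   | inj₁ (p′ , shorter) = go fuel p′ q (<-≤-trans (+-monoˡ-< (len q) shorter) (≤-pred bound))
        ...   | inj₂ (q′ , shorter) = go fuel p q′ (<-≤-trans (+-monoʳ-< (len p) shorter) (≤-pred bound))

    separator-clique : ∀ {C D : Subset (n G)} → Linked C → Linked D → Separated (_∈ C) (_∈ D) →
                       ∀ {s s′} → s ≢ s′ → Touches C s → Touches C s′ → Touches D s → Touches D s′ → Adj G s s′
    separator-clique C-linked D-linked sep s≢s′ (c , c∈C , sc) (c′ , c′∈C , s′c′) (d , d∈D , sd) (d′ , d′∈D , s′d′) =
      separated-paths sep (detour sc (walk (C-linked c∈C c′∈C)) (adj-sym s′c′))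
                          (detour s′d′ (walk (D-linked d′∈D d∈D)) (adj-sym sd)) s≢s′

  module CommonNeighbour (G : Graph) (chordal : Chordal G) where
    open GraphFacts G
    open IndexedWalks G
    open Walk
    open SeparatedPaths G chordal

    -- Let ss′ be an edge outside C and w a walk in C from a neighbour of s′ to x, where x is
    -- the only vertex of w adjacent to s.  Then x is adjacent to s′: otherwise, from the last
    -- neighbour of s′ on w, the rest of w and s, s′ give separated paths, forcing an edge
    -- from s to an earlier vertex of w.
    first-contact : ∀ {C : Subset (n G)} {s s′ c x} → Adj G s s′ → s ∉ C → s′ ∉ C →
                    (w : Walk (_∈ C) c x) → Adj G c s′ → Adj G x s →
                    (∀ k → k < len w → ¬ Adj G (at w k) s) → Adj G x s′
    first-contact {C} {s} {s′} ss′ s∉C s′∉C w cs′ xs before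
      with last-index (λ k → Adj G (at w k) s′) (λ k → adj? (at w k) s′)
                      (subst (λ y → Adj G y s′) (sym (start w)) cs′) (len w)
    ... | j , j≤len , js′ , after with j ≟ len w
    ...   | yes refl = subst (λ y → Adj G y s′) (end w) js′
    ...   | no j≢len = contradiction (adj-sym s-adj-j) (before j j<len)
      where
        j<len : j < len w
        j<len = ≤∧≢⇒< j≤len j≢len
        Beyond : V → Set
        Beyond y = y ∈ C × ¬ Adj G y s′
        via-s′ : Path (_≡ s′) s (at w j)
        via-s′ = detour ss′ (stay refl) (adj-sym js′)
        via-w : Path Beyond (at w j) s
        via-w = detour (links w j j<len) (drop w (suc j) j<len (λ k j<k k≤len → every w k k≤len , after k j<k k≤len)) xs
        separated : Separated (_≡ s′) Beyond
        separated refl (y∈C , ¬ys′) = (λ s′≡y → s′∉C (subst (_∈ C) (sym s′≡y) y∈C)) , λ s′y → ¬ys′ (adj-sym s′y)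
        s-adj-j : Adj G s (at w j)
        s-adj-j = separated-paths separated via-s′ via-w (λ s≡wj → s∉C (subst (_∈ C) (sym s≡wj) (every w j j≤len)))

    -- A common neighbour c ∈ C of the clique L moves inside C to a common neighbour of L
    -- and one further clique vertex s: the first vertex adjacent to s on a walk from c to a
    -- neighbour of s.
    absorb : ∀ {C : Subset (n G)} {L : V → Set} {s c u} → (w : Walk (_∈ C) c u) → Adj G u s → s ∉ C →
             (∀ {s′} → L s′ → s′ ∉ C) → (∀ {s′} → L s′ → s ≢ s′ → Adj G s s′) → (∀ {s′} → L s′ → Adj G c s′) →
             ∃ λ x → x ∈ C × Adj G x s × (∀ {s′} → L s′ → Adj G x s′)
    absorb {C} {L} {s} w us s∉C L∉C s-adj c-adj
      with first-index (λ k → Adj G (at w k) s) (λ k → adj? (at w k) s) (len w) (subst (λ y → Adj G y s) (sym (end w)) us)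
    ... | i , i≤len , is , before = at w i , every w i i≤len , is , adjacent
      where
        adjacent : ∀ {s′} → L s′ → Adj G (at w i) s′
        adjacent {s′} s′∈L with s′ ≟ᶠ s
        ... | yes refl = is
        ... | no s′≢s = first-contact (s-adj s′∈L (≢-sym s′≢s)) s∉C (L∉C s′∈L) (take w i i≤len) (c-adj s′∈L) is before

    common-neighbour : ∀ {C : Subset (n G)} → Linked C → ∀ {w} → w ∈ C → (L : List V) →
                       (∀ {s} → s ∈ₗ L → s ∉ C) → (∀ {s} → s ∈ₗ L → Touches C s) →
                       (∀ {s s′} → s ∈ₗ L → s′ ∈ₗ L → s ≢ s′ → Adj G s s′) →
                       ∃ λ c → c ∈ C × (∀ {s} → s ∈ₗ L → Adj G c s)
    common-neighbour linked w∈C [] _ _ _ = _ , w∈C , λ ()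
    common-neighbour linked w∈C (s ∷ L) L∉C touches clique
      with common-neighbour linked w∈C L (λ p → L∉C (there p)) (λ p → touches (there p))
                            (λ p p′ → clique (there p) (there p′))
    ... | c , c∈C , c-adj with touches (here refl)
    ...   | u , u∈C , su with absorb (walk (linked c∈C u∈C)) (adj-sym su) (L∉C (here refl))
                                     (λ p → L∉C (there p)) (λ p → clique (here refl) (there p)) c-adj
    ...     | x , x∈C , xs , x-adj = x , x∈C , λ { (here refl) → xs ; (there p) → x-adj p }

  module Spreading (G : Graph) (chordal : Chordal G) (t : ℕ) (conn : Connected t G)
                   (H : Subset (n G)) (closed : ∀ u → t ≤ ∣ H ∩ N G u ∣ → u ∈ H)
                   (K : Clique G t) (K⊆H : ∀ i → Clique.vtx K i ∈ H) where
    open GraphFacts G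
    open SeparatedPaths G chordal
    open CommonNeighbour G chordal
    open Clique K

    module Outside (w : V) (w∉H : w ∉ H) where

      module ComponentC = Component (∁ H) w

      C : Subset (n G)
      C = ComponentC.vertices

      w∈C : w ∈ C
      w∈C = ComponentC.reach⇒∈ (here (x∉p⇒x∈∁p w∉H))

      C∩H : ∀ {v} → v ∈ C → v ∉ H
      C∩H v∈C = x∈∁p⇒x∉p (ComponentC.⊆ambient v∈C)

      few-in-H : ∀ {c} → c ∈ C → t ≤ ∣ H ∩ N G c ∣ → ⊥
      few-in-H {c} c∈C t≤ = C∩H c∈C (closed c t≤)

      OnBoundary : V → Set
      OnBoundary v = v ∈ H × Touches C v

      on-boundary? : ∀ v → Dec (OnBoundary v)
      on-boundary? v = (v ∈? H) ×-dec any? (λ c → (c ∈? C) ×-dec adj? v c)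

      S : Subset (n G)
      S = ⟦ on-boundary? ⟧

      boundary-common-neighbour : (L : List V) → (∀ {s} → s ∈ₗ L → OnBoundary s) →
                                  (∀ {s s′} → s ∈ₗ L → s′ ∈ₗ L → s ≢ s′ → Adj G s s′) →
                                  ∃ λ c → c ∈ C × (∀ {s} → s ∈ₗ L → Adj G c s)
      boundary-common-neighbour L on-S L-clique =
        common-neighbour ComponentC.linked w∈C L (λ s∈L s∈C → C∩H s∈C (proj₁ (on-S s∈L))) (λ s∈L → proj₂ (on-S s∈L)) L-clique

      -- If K lies on the boundary, a common neighbour in C has its t vertices in H.
      clique-on-boundary : (∀ i → OnBoundary (vtx i)) → ⊥
      clique-on-boundary on-S with boundary-common-neighbour (members K) (every-member K on-S) (members-clique K)
      ... | c , c∈C , c-adj =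
        few-in-H c∈C (injective⇒≤∣∣ (H ∩ N G c) vtx inj (λ i → x∈p∩q⁺ (K⊆H i , ∈N (c-adj (∈-tabulate⁺ i)))))

      -- Otherwise take d ∈ K ⊆ H off the boundary and its component D in G - S.  The
      -- neighbourhood S₂ of D lies in S, is a clique (as C and D are separated), and separates
      -- d from w, so ∣ S₂ ∣ ≥ t; a common neighbour in C of S₂ then has t neighbours in H.
      module Beyond (d : V) (d∈H : d ∈ H) (d∉S : d ∉ S) where

        module ComponentD = Component (∁ S) d

        D : Subset (n G)
        D = ComponentD.vertices

        d∈D : d ∈ D
        d∈D = ComponentD.reach⇒∈ (here (x∉p⇒x∈∁p d∉S))

        -- A walk avoiding S does not leave C.
        C-closed : ∀ {x y} → x ∈ C → Adj G x y → y ∈ ∁ S → y ∈ C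
        C-closed {x} {y} x∈C xy y∉S with y ∈? H
        ... | yes y∈H = ⊥-elim (x∈∁p⇒x∉p y∉S (∈⟦⟧⁺ on-boundary? (y∈H , x , x∈C , adj-sym xy)))
        ... | no y∉H = ComponentC.grows x∈C xy (x∉p⇒x∈∁p y∉H)

        C∩D : ∀ {v} → v ∈ C → v ∈ D → ⊥
        C∩D v∈C v∈D = C∩H (reach-preserves (_∈ C) C-closed (reach-sym (ComponentD.∈⇒reach v∈D)) v∈C) d∈H

        OnSeparator : V → Set
        OnSeparator v = v ∉ D × Touches D v

        on-separator? : ∀ v → Dec (OnSeparator v)
        on-separator? v = ¬? (v ∈? D) ×-dec any? (λ x → (x ∈? D) ×-dec adj? v x)

        S₂ : Subset (n G)
        S₂ = ⟦ on-separator? ⟧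

        S₂-boundary : ∀ {v} → v ∈ S₂ → OnBoundary v
        S₂-boundary {v} v∈S₂ with ∈⟦⟧⁻ on-separator? v∈S₂
        ... | v∉D , x , x∈D , vx = ∈⟦⟧⁻ on-boundary?
          (decidable-stable (v ∈? S) (λ v∉S → v∉D (ComponentD.grows x∈D (adj-sym vx) (x∉p⇒x∈∁p v∉S))))

        C-D-separated : Separated (_∈ C) (_∈ D)
        C-D-separated {x} x∈C y∈D = (λ { refl → C∩D x∈C y∈D })
                                  , λ xy → C∩H x∈C (proj₁ (S₂-boundary (∈⟦⟧⁺ on-separator? (C∩D x∈C , _ , y∈D , xy))))

        S₂-clique : ∀ {s s′} → s ∈ S₂ → s′ ∈ S₂ → s ≢ s′ → Adj G s s′
        S₂-clique s∈S₂ s′∈S₂ s≢s′ =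
          separator-clique ComponentC.linked ComponentD.linked C-D-separated s≢s′
            (proj₂ (S₂-boundary s∈S₂)) (proj₂ (S₂-boundary s′∈S₂))
            (proj₂ (∈⟦⟧⁻ on-separator? s∈S₂)) (proj₂ (∈⟦⟧⁻ on-separator? s′∈S₂))

        -- A walk avoiding S₂ does not leave D.
        D-closed : ∀ {x y} → x ∈ D → Adj G x y → y ∈ ∁ S₂ → y ∈ D
        D-closed {x} {y} x∈D xy y∉S₂ =
          decidable-stable (y ∈? D) (λ y∉D → x∈∁p⇒x∉p y∉S₂ (∈⟦⟧⁺ on-separator? (y∉D , x , x∈D , adj-sym xy)))

        S₂-large : t ≤ ∣ S₂ ∣
        S₂-large = decidable-stable (t ≤? ∣ S₂ ∣) λ t≰∣S₂∣ →
          let d-w = proj₂ conn S₂ (≰⇒> t≰∣S₂∣) d w (λ d∈S₂ → proj₁ (∈⟦⟧⁻ on-separator? d∈S₂) d∈D)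
                                                  (λ w∈S₂ → w∉H (proj₁ (S₂-boundary w∈S₂)))
          in C∩D w∈C (reach-preserves (_∈ D) D-closed d-w d∈D)

        common : ∃ λ c → c ∈ C × (∀ {s} → s ∈ₗ elements S₂ → Adj G c s)
        common = boundary-common-neighbour (elements S₂) (λ s∈ → S₂-boundary (∈elements⁻ S₂ s∈))
                                           (λ s∈ s′∈ → S₂-clique (∈elements⁻ S₂ s∈) (∈elements⁻ S₂ s′∈))

        S₂⊆H∩N : S₂ ⊆ H ∩ N G (proj₁ common)
        S₂⊆H∩N v∈S₂ = x∈p∩q⁺ (proj₁ (S₂-boundary v∈S₂) , ∈N (proj₂ (proj₂ common) (∈elements⁺ S₂ v∈S₂)))

        absurd : ⊥
        absurd = few-in-H (proj₁ (proj₂ common)) (≤-trans S₂-large (p⊆q⇒∣p∣≤∣q∣ S₂⊆H∩N))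

      absurd : ⊥
      absurd = by-cases (all? (λ i → on-boundary? (vtx i)))
        where
          by-cases : Dec (∀ i → OnBoundary (vtx i)) → ⊥
          by-cases (yes on-S) = clique-on-boundary on-S
          by-cases (no ¬on-S) =
            let (i , off-S) = ¬∀⟶∃¬ t _ (λ i → on-boundary? (vtx i)) ¬on-S
            in Beyond.absurd (vtx i) (K⊆H i) (off-S ∘ ∈⟦⟧⁻ on-boundary?)

    spreading : ∀ w → w ∈ H
    spreading w = decidable-stable (w ∈? H) (λ w∉H → Outside.absurd w w∉H)

  module CliqueExistence (G : Graph) (chordal : Chordal G) (t : ℕ) (conn : Connected t G) where
    open GraphFacts G
    open CommonNeighbour G chordal

    -- A clique of order k < t grows by one vertex: G - X stays connected for a set X ⊇ K of
    -- size ≤ k, each vertex v of K has a neighbour outside X (G - (X - v) is connected too),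
    -- and a common neighbour of K outside X extends K.
    extend : ∀ {k} → Clique G k → k < t → Clique G (suc k)
    extend {k} K k<t = record { vtx = vtx′ ; inj = inj′ ; adjc = adjc′ }
      where
        open Clique K
        X : Subset (n G)
        X = proj₁ (image-cover vtx)
        vtx∈X : ∀ i → vtx i ∈ X
        vtx∈X = proj₁ (proj₂ (image-cover vtx))
        ∣X∣<t : ∣ X ∣ < t
        ∣X∣<t = ≤-<-trans (proj₂ (proj₂ (image-cover vtx))) k<t
        w : V
        w = proj₁ (small⇒missing X (<-trans ∣X∣<t (proj₁ conn)))
        w∉X : w ∉ X
        w∉X = proj₂ (small⇒missing X (<-trans ∣X∣<t (proj₁ conn)))
        linked : Linked (∁ X)
        linked a∈ b∈ = proj₂ conn X ∣X∣<t _ _ (x∈∁p⇒x∉p a∈) (x∈∁p⇒x∉p b∈)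
        escape : ∀ i → Touches (∁ X) (vtx i)
        escape i with first-step (proj₂ conn (X - vtx i) (≤-<-trans (∣p─q∣≤∣p∣ X ⁅ vtx i ⁆) ∣X∣<t) (vtx i) w
                                    (λ v∈ → x∈p-y⇒x≢y X v∈ refl) (λ w∈ → w∉X (p─q⊆p X ⁅ vtx i ⁆ w∈)))
                                 (λ v≡w → w∉X (subst (_∈ X) v≡w (vtx∈X i)))
        ... | y , vy , y∉X-v = y , x∉p⇒x∈∁p (λ y∈X → x∈∁p⇒x∉p y∉X-v (x∈p∧x≢y⇒x∈p-y y∈X (≢-sym (adj⇒≢ vy)))) , vy
        common : ∃ λ c → c ∈ ∁ X × (∀ {s} → s ∈ₗ members K → Adj G c s)
        common = common-neighbour linked (x∉p⇒x∈∁p w∉X) (members K)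
                   (every-member K (λ i v∈∁X → x∈∁p⇒x∉p v∈∁X (vtx∈X i))) (every-member K escape) (members-clique K)
        c : V
        c = proj₁ common
        c∉X : c ∉ X
        c∉X = x∈∁p⇒x∉p (proj₁ (proj₂ common))
        c-adj : ∀ i → Adj G c (vtx i)
        c-adj i = proj₂ (proj₂ common) (∈-tabulate⁺ i)
        vtx′ : Fin (suc k) → V
        vtx′ zero = c
        vtx′ (suc i) = vtx i
        inj′ : Injective _≡_ _≡_ vtx′
        inj′ {zero} {zero} _ = refl
        inj′ {zero} {suc j} c≡v = ⊥-elim (c∉X (subst (_∈ X) (sym c≡v) (vtx∈X j)))
        inj′ {suc i} {zero} v≡c = ⊥-elim (c∉X (subst (_∈ X) v≡c (vtx∈X i)))
        inj′ {suc i} {suc j} v≡v = cong suc (inj v≡v)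
        adjc′ : ∀ i j → i ≢ j → Adj G (vtx′ i) (vtx′ j)
        adjc′ zero zero i≢j = ⊥-elim (i≢j refl)
        adjc′ zero (suc j) _ = c-adj j
        adjc′ (suc i) zero _ = adj-sym (c-adj i)
        adjc′ (suc i) (suc j) i≢j = adjc i j (λ i≡j → i≢j (cong suc i≡j))

    clique : ∀ k → k ≤ t → Clique G k
    clique zero _ = record { vtx = λ () ; inj = λ { {()} } ; adjc = λ () }
    clique (suc k) k<t = extend (clique k (<⇒≤ k<t)) k<t

  module Incentive (G : Graph) where
    open GraphFacts G

    -- If θ(v_i) ≤ i, a set closed for θ contains v₀, v₁, … in turn: v₀, …, v_{i-1} are i
    -- neighbours of v_i inside it.
    clique-cascade : ∀ {k} (K : Clique G k) (θ : V → ℤ) (H : Subset (n G)) →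
                     (∀ i → θ (Clique.vtx K i) ℤ.≤ + toℕ i) → Closed G θ H → ∀ i → Clique.vtx K i ∈ H
    clique-cascade K θ H θ≤i closed i₀ = enters (suc (toℕ i₀)) i₀ ≤-refl
      where
        open Clique K
        enters : ∀ b i → toℕ i < b → vtx i ∈ H
        enters (suc b) i i<b = closed (vtx i) (ℤ.≤-trans (θ≤i i) (+≤+ (injective⇒≤∣∣ _ earlier earlier-inj earlier∈)))
          where
            earlier : Fin (toℕ i) → V
            earlier j = vtx (Fin.inject j)
            before-i : ∀ j → toℕ (Fin.inject {i = i} j) < toℕ i
            before-i j = subst (_< toℕ i) (sym (toℕ-inject j)) (toℕ<n j)
            earlier-inj : Injective _≡_ _≡_ earlier
            earlier-inj {j} {j′} e = toℕ-injective (trans (sym (toℕ-inject j)) (trans (cong toℕ (inj e)) (toℕ-inject j′)))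
            earlier∈ : ∀ j → earlier j ∈ H ∩ N G (vtx i)
            earlier∈ j = x∈p∩q⁺ ( enters b (Fin.inject j) (<-≤-trans (before-i j) (≤-pred i<b))
                                , ∈N (adjc i (Fin.inject j) (λ i≡ → <-irrefl (cong toℕ (sym i≡)) (before-i j))))

    -- Part (i).  Every set H closed for τ - σ contains K by the cascade, and is closed under
    -- "t neighbours in H" since τ - σ ≤ τ ≤ t; so H is everything.
    clique-incentive-works : Chordal G → ∀ t → Connected t G → (τ : V → ℤ) → (∀ u → τ u ℤ.≤ + t) →
                             (K : Clique G t) (σ : V → ℕ) →
                             (∀ i → σ (Clique.vtx K i) ≡ pos (τ (Clique.vtx K i) ℤ.- + toℕ i)) →
                             PartialIncentive G τ σ
    clique-incentive-works chordal t conn τ τ≤t K σ σ-on-K = full , (⊥⊆ , (λ _ _ → ∈⊤) , least) , refl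
      where
        open Clique K
        θ : V → ℤ
        θ u = τ u ℤ.- + σ u
        θ-on-K : ∀ i → θ (vtx i) ℤ.≤ + toℕ i
        θ-on-K i = subst (λ s → τ (vtx i) ℤ.- + s ℤ.≤ + toℕ i) (sym (σ-on-K i)) (incentive-residual (τ (vtx i)) (toℕ i))
        least : ∀ H → ∅ ⊆ H → Closed G θ H → full ⊆ H
        least H _ H-closed {u} _ = Spreading.spreading G chordal t conn H t-closed K (clique-cascade K θ H θ-on-K H-closed) u
          where
            t-closed : ∀ u → t ≤ ∣ H ∩ N G u ∣ → u ∈ H
            t-closed u t≤ = H-closed u (ℤ.≤-trans (ℤ.i-j≤i (τ u) (+ σ u)) (ℤ.≤-trans (τ≤t u) (+≤+ t≤)))

    clique-incentive : ∀ {k} → Clique G k → (V → ℤ) → V → ℕ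
    clique-incentive K τ u with any? (λ i → Clique.vtx K i ≟ᶠ u)
    ... | yes (i , _) = pos (τ u ℤ.- + toℕ i)
    ... | no _ = 0

    clique-incentive-on : ∀ {k} (K : Clique G k) τ i →
                          clique-incentive K τ (Clique.vtx K i) ≡ pos (τ (Clique.vtx K i) ℤ.- + toℕ i)
    clique-incentive-on K τ i with any? (λ j → Clique.vtx K j ≟ᶠ Clique.vtx K i)
    ... | yes (j , vj≡vi) with Clique.inj K vj≡vi
    ...   | refl = refl
    clique-incentive-on K τ i | no none = ⊥-elim (none (i , refl))

    clique-incentive-off : ∀ {k} (K : Clique G k) τ u → (∀ i → u ≢ Clique.vtx K i) → clique-incentive K τ u ≡ 0
    clique-incentive-off K τ u u∉K with any? (λ i → Clique.vtx K i ≟ᶠ u)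
    ... | yes (i , vi≡u) = ⊥-elim (u∉K i (sym vi≡u))
    ... | no _ = refl

    clique-incentive-total : ∀ {t} (K : Clique G t) (τ : V → ℤ) → (∀ u → τ u ℤ.≤ + t) →
                             total G (clique-incentive K τ) ≤ suc t choose 2
    clique-incentive-total {t} K τ τ≤t = begin
      sum (tabulate σ)                          ≡⟨ sum-supported vtx inj σ (clique-incentive-off K τ) ⟩
      sum (tabulate (σ ∘ vtx))                  ≤⟨ sum-mono (σ ∘ vtx) (λ i → t ∸ toℕ i) bound ⟩
      sum (tabulate (λ (i : Fin t) → t ∸ toℕ i)) ≡⟨ triangular t ⟩
      suc t choose 2                            ∎
      where
        open ≤-Reasoning
        open Clique K
        σ : V → ℕ
        σ = clique-incentive K τ
        bound : ∀ i → σ (vtx i) ≤ t ∸ toℕ i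
        bound i = subst (_≤ t ∸ toℕ i) (sym (clique-incentive-on K τ i)) (incentive-bound (τ (vtx i)) (toℕ i) t (τ≤t (vtx i)))

    pi-bound : Chordal G → ∀ t → Connected t G → (τ : V → ℤ) → (∀ u → τ u ℤ.≤ + t) → PiAtMost G τ (suc t choose 2)
    pi-bound chordal t conn τ τ≤t =
      clique-incentive K τ , clique-incentive-works chordal t conn τ τ≤t K _ (clique-incentive-on K τ) , clique-incentive-total K τ τ≤t
      where
        K : Clique G t
        K = CliqueExistence.clique G chordal t conn t ≤-refl

open import Data.Nat using (ℕ; suc)
open import Data.Nat.Combinatorics using (_C_)
open import Data.Integer using (ℤ; +_; _-_; _≤_)
open import Data.Fin using (Fin; toℕ)
open import Data.Product using (_×_; _,_)
open import Relation.Binary.PropositionalEquality using (_≡_; _≢_)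

-- Part (i) does not need σ to vanish off the clique: extra incentive only lowers thresholds.
lemma12 : (t : ℕ) (G : Graph) → Connected t G → Chordal G →
    (τ : Fin (n G) → ℤ) → (∀ u → τ u ≤ + t) →
    ((K : Clique G t) (σ : Fin (n G) → ℕ) →
      (∀ i → σ (Clique.vtx K i) ≡ pos (τ (Clique.vtx K i) - + toℕ i)) →
      (∀ u → (∀ i → u ≢ Clique.vtx K i) → σ u ≡ 0) →
      PartialIncentive G τ σ)
    × PiAtMost G τ (suc t C 2)
lemma12 t G conn chordal τ τ≤t =
  (λ K σ σ-on-K _ → clique-incentive-works chordal t conn τ τ≤t K σ σ-on-K) ,
  pi-bound chordal t conn τ τ≤t
  where open Development.Incentive G
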